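{- Let $T$ be a skew-nontrivial tree. Then $\mathrm{Z}_-(T)=\mathrm{Z}_+(SD_2(T))$ and $\mathcal{TE}_-(T)=\mathcal{TE}_+(SD_2(T))$.
   Context: Skew forcing on a graph $G$: vertices are blue or white; from an initial blue set $B$ (possibly empty), repeatedly apply: if any vertex $u$ (blue or white) has exactly one white neighbor $w$, then $w$ becomes blue. $B$ is a skew forcing set if eventually all vertices are blue; $\mathrm{Z}_-(G)$ is the minimum size of one. PSD forcing: from an initial blue set $B$, repeatedly apply: if $C$ is a connected component of the graph obtained from $G$ by deleting the currently blue vertices and $u$ is a blue vertex with $N_G(u)\cap V(C)=\{w\}$, then $w$ becomes blue; PSD forcing sets and $\mathrm{Z}_+(G)$ are defined analogously. For $X\in\{\mathrm{Z}_-,\mathrm{Z}_+\}$, the token exchange graph ($\mathcal{TE}_-$ resp. $\mathcal{TE}_+$) has as vertices the $X$-forcing sets of size $X(G)$, with $S_1S_2$ an edge iff there are $v_1\in S_1\setminus S_2$, $v_2\in S_2\setminus S_1$ with $S_1\setminus\{v_1\}=S_2\setminus\{v_2\}$. Let $B^\emptyset_-(G)$ be the set of blue vertices obtained by applying the skew forcing rule starting from the empty blue set until no further forces are possible, and $W^\emptyset_-(G)=V(G)\setminus B^\emptyset_-(G)$. The skew-nontrivial subgraph of $G$ is obtained from $G$ by deleting every vertex of $B^\emptyset_-(G)$ all of whose neighbors lie in $B^\emptyset_-(G)$ and deleting every edge with both endpoints in $B^\emptyset_-(G)$; $G$ is skew-nontrivial if this subgraph equals $G$. For a skew-nontrivial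 tree $T$, $SD_2(T)$ is the graph with vertex set $W^\emptyset_-(T)$ in which distinct $u,w$ are adjacent iff $N_T(u)\cap N_T(w)\neq\emptyset$. -}

module Defs where

open import Data.Nat using (ℕ; suc; _≤_)
open import Data.Bool using (Bool; true; false)
open import Data.Fin using (Fin)
open import Data.Fin.Subset using (Subset; _∈_; _∉_; _⊆_; _∪_; ⁅_⁆; _-_; ∣_∣; ⊥)
open import Data.List using (List; []; _∷_; _∷ʳ_; length)
open import Data.List.Relation.Unary.Linked using (Linked)
open import Data.List.Relation.Unary.Unique.Propositional using (Unique)
open import Data.Product using (Σ; _×_; ∃; ∃-syntax)
open import Relation.Binary.PropositionalEquality using (_≡_; _≢_)
open import Relation.Nullary using (¬_)
open import Function.Bundles using (_⇔_)
import Data.Empty as E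

record Graph (n : ℕ) : Set where
  field
    adj    : Fin n → Fin n → Bool
    sym    : ∀ u v → adj u v ≡ adj v u
    irrefl : ∀ u → adj u u ≡ false

module _ {n : ℕ} (G : Graph n) where
  open Graph G

  Adj : Fin n → Fin n → Set
  Adj u v = adj u v ≡ true

  data Walk : Fin n → Fin n → Set where
    here : ∀ {u} → Walk u u
    step : ∀ {u v w} → Adj u v → Walk v w → Walk u w

  Connected : Set
  Connected = ∀ u v → Walk u v

  IsCycle : Fin n → List (Fin n) → Set
  IsCycle v vs = Unique (v ∷ vs) × 2 ≤ length vs × Linked Adj ((v ∷ vs) ∷ʳ v)

  Acyclic : Set
  Acyclic = ∀ v vs → ¬ IsCycle v vs

IsTree : {n : ℕ} → Graph n → Set
IsTree {n} G = 1 ≤ n × Connected G × Acyclic G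

module _ {n : ℕ} (G : Graph n) where

  -- With blue set S, some vertex u (any colour) has w as its unique white neighbour.
  SkewStep : Subset n → Fin n → Set
  SkewStep S w = Σ (Fin n) λ u →
    Adj G u w × w ∉ S × (∀ x → Adj G u x → x ≢ w → x ∈ S)

  data SkewRun : Subset n → Set where
    done  : ∀ {S} → (∀ v → v ∈ S) → SkewRun S
    force : ∀ {S} w → SkewStep S w → SkewRun (S ∪ ⁅ w ⁆) → SkewRun S

  SkewForcingSet : Subset n → Set
  SkewForcingSet B = SkewRun B

  -- B^∅_-(G): vertices turned blue by skew forcing from the empty set
  -- (inductive closure = final set of the (monotone) process)
  data InB∅ : Fin n → Set where
    forced : ∀ u w → Adj G u w → (∀ x → Adj G u x → x ≢ w → InB∅ x) → InB∅ w

  InW∅ : Fin n → Set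
  InW∅ v = ¬ InB∅ v

  -- the skew-nontrivial subgraph equals G: no vertex of B^∅ has all its
  -- neighbours in B^∅, and no edge has both endpoints in B^∅
  SkewNontrivial : Set
  SkewNontrivial =
    (∀ v → InB∅ v → ¬ (∀ x → Adj G v x → InB∅ x)) ×
    (∀ u v → Adj G u v → InB∅ u → InB∅ v → E.⊥)

-- PSD forcing on a graph H given by a vertex set V ⊆ Fin n and an
-- adjacency relation A (only used between vertices of V)

module _ {n : ℕ} (V : Fin n → Set) (A : Fin n → Fin n → Set) where

  data WhiteWalk (S : Subset n) : Fin n → Fin n → Set where
    here : ∀ {u} → V u → u ∉ S → WhiteWalk S u u
    step : ∀ {u v w} → V u → u ∉ S → A u v → WhiteWalk S v w → WhiteWalk S u w

  -- blue u forces w: w is the only neighbour of u in the component of H − S containing w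
  PSDStep : Subset n → Fin n → Set
  PSDStep S w = Σ (Fin n) λ u →
    u ∈ S × V u × A u w × V w × w ∉ S ×
    (∀ x → V x → A u x → x ≢ w → x ∉ S → ¬ WhiteWalk S x w)

  data PSDRun : Subset n → Set where
    done  : ∀ {S} → (∀ v → V v → v ∈ S) → PSDRun S
    force : ∀ {S} w → PSDStep S w → PSDRun (S ∪ ⁅ w ⁆) → PSDRun S

  PSDForcingSet : Subset n → Set
  PSDForcingSet B = (∀ v → v ∈ B → V v) × PSDRun B

SD₂-V : {n : ℕ} → Graph n → Fin n → Set
SD₂-V T = InW∅ T

SD₂-A : {n : ℕ} → Graph n → Fin n → Fin n → Set
SD₂-A T u w = u ≢ w × ∃[ x ] (Adj T u x × Adj T w x)

IsMinSize : {n : ℕ} → (Subset n → Set) → ℕ → Set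
IsMinSize P k = (∃[ B ] (P B × ∣ B ∣ ≡ k)) × (∀ B → P B → k ≤ ∣ B ∣)

TEVertex : {n : ℕ} → (Subset n → Set) → ℕ → Subset n → Set
TEVertex P k S = P S × ∣ S ∣ ≡ k

TEAdj : {n : ℕ} → Subset n → Subset n → Set
TEAdj S₁ S₂ = ∃[ v₁ ] ∃[ v₂ ]
  (v₁ ∈ S₁ × v₁ ∉ S₂ × v₂ ∈ S₂ × v₂ ∉ S₁ × S₁ - v₁ ≡ S₂ - v₂)

TEEdge : {n : ℕ} → (Subset n → Set) → ℕ → Subset n → Subset n → Set
TEEdge P k S₁ S₂ = TEVertex P k S₁ × TEVertex P k S₂ × TEAdj S₁ S₂

-- Skew forcing on T and PSD forcing on SD₂(T) perform the same forces. If x skew-forces w,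
-- some other neighbour u of x lies outside B^∅_-(T) (else x would force w from the empty
-- set); u is blue and adjacent to w in SD₂(T) through x, and u PSD-forces w. Indeed another
-- SD₂-neighbour z of u shares a T-neighbour y ≠ x with u; as T is bipartite and SD₂-steps
-- are T-walks of length two, a white SD₂-walk from z to w unfolds to a T-walk from y to w
-- avoiding u, which joins the neighbours y and x of u in T − u, impossible in a forest.
-- Conversely a skew-closed set is PSD-closed in SD₂(T). Finally a minimum skew forcing set
-- avoids B^∅_-(T), so the minimum forcing sets of the two processes coincide.
module Submission where

open import Defs
open import Data.Bool using (Bool; true; false; not; _xor_)
open import Data.Bool.Properties using (not-involutive; not-distribˡ-xor; true-xor; xor-comm)
import Data.Bool.Properties as Bool
open import Data.Empty using (⊥; ⊥-elim)
open import Data.Fin using (Fin; _≟_)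
open import Data.Fin.Properties using (any?; all?)
open import Data.Fin.Subset using (Subset; _∈_; _∉_; _⊆_; _∪_; ⁅_⁆; _-_; ∣_∣; ⊤) renaming (⊥ to ∅)
open import Data.Fin.Subset.Properties
  using (_∈?_; ∉⊥; ∈⊤; p⊆p∪q; q⊆p∪q; x∈p∪q⁻; x∈p∪q⁺; x∈⁅x⁆; x∈⁅y⁆⇒x≡y; ∣p∣≤n; ∣p∣≡n⇒p≡⊤;
         p⊂q⇒∣p∣<∣q∣; x∈p⇒∣p-x∣<∣p∣; x∈p∧x≢y⇒x∈p-y; anySubset?)
open import Data.List using (List; []; _∷_; _∷ʳ_; length)
open import Data.List.Membership.Propositional using () renaming (_∈_ to _∈ₗ_; _∉_ to _∉ₗ_)
open import Data.List.Relation.Unary.All using ([]; _∷_)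
import Data.List.Relation.Unary.All as All
open import Data.List.Relation.Unary.All.Properties using (¬Any⇒All¬)
open import Data.List.Relation.Unary.AllPairs using ([]; _∷_)
open import Data.List.Relation.Unary.Any using (here; there)
open import Data.List.Relation.Unary.Linked using (Linked; [-]; _∷_)
open import Data.List.Relation.Unary.Unique.Propositional using (Unique)
open import Data.Nat using (ℕ; zero; suc; _≤_; _<_; _+_; z≤n; s≤s)
open import Data.Nat.Properties
  using (≤-trans; ≤-reflexive; ≤-antisym; ≮⇒≥; +-suc; +-monoʳ-≤; m≤m+n; <-irrefl; ≤-<-trans; _≤?_)
open import Data.Product using (Σ; _×_; _,_; ∃-syntax; proj₁; proj₂)
open import Data.Sum using (_⊎_; inj₁; inj₂; [_,_]′)
open import Function using (_∘_; id; case_of_)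
open import Function.Bundles using (module Equivalence; _⇔_; mk⇔)
open import Relation.Binary.PropositionalEquality
  using (_≡_; _≢_; refl; sym; trans; cong; subst; module ≡-Reasoning)
open import Relation.Nullary using (¬_; Dec; yes; no; contradiction)
open import Relation.Nullary.Decidable using (_×-dec_; _→-dec_; ¬?)
open import Relation.Unary using (Decidable)

∪⁅⁆⁻ : ∀ {n} {S : Subset n} {w x} → x ∈ S ∪ ⁅ w ⁆ → x ∈ S ⊎ x ≡ w
∪⁅⁆⁻ {S = S} {w} m with x∈p∪q⁻ S ⁅ w ⁆ m
... | inj₁ x∈S = inj₁ x∈S
... | inj₂ x∈w = inj₂ (x∈⁅y⁆⇒x≡y w x∈w)

∪⁅⁆-mono : ∀ {n} {S S′ : Subset n} {w x} → (x ∈ S → x ∈ S′) → x ∈ S ∪ ⁅ w ⁆ → x ∈ S′ ∪ ⁅ w ⁆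
∪⁅⁆-mono f m with ∪⁅⁆⁻ m
... | inj₁ x∈S = x∈p∪q⁺ (inj₁ (f x∈S))
... | inj₂ refl = x∈p∪q⁺ (inj₂ (x∈⁅x⁆ _))

∪⁅⁆-lub : ∀ {n} {S C : Subset n} {w} → S ⊆ C → w ∈ C → S ∪ ⁅ w ⁆ ⊆ C
∪⁅⁆-lub S⊆C w∈C m with ∪⁅⁆⁻ m
... | inj₁ x∈S = S⊆C x∈S
... | inj₂ refl = w∈C

module Walks {n : ℕ} (G : Graph n) where

  open import Data.List.Membership.DecPropositional (_≟_ {n}) using () renaming (_∈?_ to _∈ₗ?_)

  Adj-sym : ∀ {u v} → Adj G u v → Adj G v u
  Adj-sym {u} {v} e = trans (Graph.sym G v u) e

  Adj-irrefl : ∀ {u} → ¬ Adj G u u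
  Adj-irrefl {u} e with trans (sym e) (Graph.irrefl G u)
  ... | ()

  vertices : ∀ {a b} → Walk G a b → List (Fin n)
  vertices (here {u}) = u ∷ []
  vertices (step {u} _ p) = u ∷ vertices p

  _∈ʷ_ : ∀ {a b} → Fin n → Walk G a b → Set
  x ∈ʷ p = x ∈ₗ vertices p

  _∉ʷ_ : ∀ {a b} → Fin n → Walk G a b → Set
  x ∉ʷ p = x ∉ₗ vertices p

  IsPath : ∀ {a b} → Walk G a b → Set
  IsPath p = Unique (vertices p)

  parity : ∀ {a b} → Walk G a b → Bool
  parity here = false
  parity (step _ p) = not (parity p)

  infixr 5 _++ʷ_
  infixl 5 _▷_

  _++ʷ_ : ∀ {a b c} → Walk G a b → Walk G b c → Walk G a c
  here ++ʷ q = q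
  step e p ++ʷ q = step e (p ++ʷ q)

  _▷_ : ∀ {a b c} → Walk G a b → Adj G b c → Walk G a c
  p ▷ e = p ++ʷ step e here

  start∈ʷ : ∀ {a b} (p : Walk G a b) → a ∈ʷ p
  start∈ʷ here = here refl
  start∈ʷ (step _ _) = here refl

  end∈ʷ : ∀ {a b} (p : Walk G a b) → b ∈ʷ p
  end∈ʷ here = here refl
  end∈ʷ (step _ p) = there (end∈ʷ p)

  ∈ʷ-++ˡ : ∀ {a b c x} (p : Walk G a b) (q : Walk G b c) → x ∈ʷ p → x ∈ʷ (p ++ʷ q)
  ∈ʷ-++ˡ here q (here refl) = start∈ʷ q
  ∈ʷ-++ˡ (step e p) q (here refl) = here refl
  ∈ʷ-++ˡ (step e p) q (there m) = there (∈ʷ-++ˡ p q m)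

  ∈ʷ-++ʳ : ∀ {a b c x} (p : Walk G a b) {q : Walk G b c} → x ∈ʷ q → x ∈ʷ (p ++ʷ q)
  ∈ʷ-++ʳ here m = m
  ∈ʷ-++ʳ (step e p) m = there (∈ʷ-++ʳ p m)

  ∉ʷ-▷ : ∀ {a b c x} (p : Walk G a b) (e : Adj G b c) → x ∉ʷ p → x ≢ c → x ∉ʷ (p ▷ e)
  ∉ʷ-▷ here e x∉p x≢c (here refl) = x∉p (here refl)
  ∉ʷ-▷ here e x∉p x≢c (there (here refl)) = x≢c refl
  ∉ʷ-▷ (step _ p) e x∉p x≢c (here refl) = x∉p (here refl)
  ∉ʷ-▷ (step _ p) e x∉p x≢c (there m) = ∉ʷ-▷ p e (x∉p ∘ there) x≢c m

  split-at : ∀ {a b x} (p : Walk G a b) → x ∈ʷ p →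
             Σ (Walk G a x) λ pre → Σ (Walk G x b) λ suf → p ≡ pre ++ʷ suf
  split-at here (here refl) = here , here , refl
  split-at (step e p) (here refl) = here , step e p , refl
  split-at (step e p) (there m) with split-at p m
  ... | pre , suf , refl = step e pre , suf , refl

  prefix-path : ∀ {a b c} (p : Walk G a b) (q : Walk G b c) → IsPath (p ++ʷ q) → IsPath p
  prefix-path here q _ = [] ∷ []
  prefix-path (step e p) q (u∉ ∷ path) =
    All.tabulate (λ m → All.lookup u∉ (∈ʷ-++ˡ p q m)) ∷ prefix-path p q path

  suffix-path : ∀ {a b c} (p : Walk G a b) {q : Walk G b c} → IsPath (p ++ʷ q) → IsPath q
  suffix-path here path = path
  suffix-path (step e p) (_ ∷ path) = suffix-path p path

  parity-++ : ∀ {a b c} (p : Walk G a b) (q : Walk G b c) → parity (p ++ʷ q) ≡ parity p xor parity q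
  parity-++ here q = refl
  parity-++ (step e p) q = trans (cong not (parity-++ p q)) (not-distribˡ-xor (parity p) (parity q))

  parity-▷ : ∀ {a b c} (p : Walk G a b) (e : Adj G b c) → parity (p ▷ e) ≡ not (parity p)
  parity-▷ p e = trans (parity-++ p (step e here)) (trans (xor-comm (parity p) true) (true-xor (parity p)))

  parity-▷▷ : ∀ {a b c d} (p : Walk G a b) (e : Adj G b c) (e′ : Adj G c d) → parity (p ▷ e ▷ e′) ≡ parity p
  parity-▷▷ p e e′ = trans (parity-▷ (p ▷ e) e′) (trans (cong not (parity-▷ p e)) (not-involutive _))

  linked-▷ : ∀ {a b c} (p : Walk G a b) → Adj G b c → Linked (Adj G) (vertices p ∷ʳ c)
  linked-▷ here e = e ∷ [-]
  linked-▷ (step e here) e′ = e ∷ e′ ∷ [-]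
  linked-▷ (step e (step e₁ p)) e′ = e ∷ linked-▷ (step e₁ p) e′

  module Acyclicity (acyclic : Acyclic G) where

    long-path-ends-nonadjacent : ∀ {v v′ v″ a} (e : Adj G v v′) (e′ : Adj G v′ v″) (r : Walk G v″ a) →
                                 IsPath (step e (step e′ r)) → ¬ Adj G a v
    long-path-ends-nonadjacent {v} e e′ r path av =
      acyclic v (vertices (step e′ r)) (path , s≤s (two-vertices r) , linked-▷ (step e (step e′ r)) av)
      where
      two-vertices : ∀ {b c} (q : Walk G b c) → 1 ≤ length (vertices q)
      two-vertices here = s≤s z≤n
      two-vertices (step _ _) = s≤s z≤n

    path-to-neighbour-odd : ∀ {a v} → Adj G a v → (p : Walk G v a) → IsPath p → parity p ≡ true
    path-to-neighbour-odd av here _ = ⊥-elim (Adj-irrefl av)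
    path-to-neighbour-odd av (step e here) _ = refl
    path-to-neighbour-odd av (step e (step e′ r)) path = ⊥-elim (long-path-ends-nonadjacent e e′ r path av)

    PathWithin : ∀ {a b} → Walk G a b → Set
    PathWithin {a} {b} w =
      Σ (Walk G a b) λ p → IsPath p × (∀ {x} → x ∈ʷ p → x ∈ʷ w) × parity p ≡ parity w

    -- The loop a – v ⋯ a cut out has length two: a longer pre closes a cycle with a – v.
    shortcut : ∀ {a v b} (e : Adj G a v) {w : Walk G v b} {p : Walk G v b} →
               (Σ (Walk G v a) λ pre → Σ (Walk G a b) λ suf → p ≡ pre ++ʷ suf) →
               IsPath p → (∀ {x} → x ∈ʷ p → x ∈ʷ w) → parity p ≡ parity w → PathWithin (step e w)
    shortcut e {w} (pre , suf , refl) path p⊆w parity≡ =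
      suf , suffix-path pre path , (λ m → there (p⊆w (∈ʷ-++ʳ pre m))) , suf-parity
      where
      open ≡-Reasoning
      pre-odd : parity pre ≡ true
      pre-odd = path-to-neighbour-odd e pre (prefix-path pre suf path)
      suf-parity : parity suf ≡ not (parity w)
      suf-parity = begin
        parity suf                      ≡⟨ sym (not-involutive _) ⟩
        not (not (parity suf))          ≡⟨ cong not (sym (true-xor (parity suf))) ⟩
        not (true xor parity suf)       ≡⟨ cong (λ b → not (b xor parity suf)) (sym pre-odd) ⟩
        not (parity pre xor parity suf) ≡⟨ cong not (sym (parity-++ pre suf)) ⟩
        not (parity (pre ++ʷ suf))      ≡⟨ cong not parity≡ ⟩
        not (parity w)                  ∎

    walk⇒path : ∀ {a b} (w : Walk G a b) → PathWithin w
    walk⇒path here = here , [] ∷ [] , id , refl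
    walk⇒path (step {a} e w) with walk⇒path w
    ... | p , path , p⊆w , parity≡ with a ∈ₗ? vertices p
    ...   | yes a∈p = shortcut e (split-at p a∈p) path p⊆w parity≡
    ...   | no a∉p = step e p , ¬Any⇒All¬ _ a∉p ∷ path , step⊆ , cong not parity≡
      where
      step⊆ : ∀ {x} → x ∈ʷ step e p → x ∈ʷ step e w
      step⊆ (here refl) = here refl
      step⊆ (there m) = there (p⊆w m)

    closed-walk-even : ∀ {a} (c : Walk G a a) → parity c ≡ false
    closed-walk-even c with walk⇒path c
    ... | here , _ , _ , parity≡ = sym parity≡
    ... | step e p , (a∉p ∷ _) , _ , _ = ⊥-elim (All.lookup a∉p (end∈ʷ p) refl)

    neighbours-separated : ∀ {u y x} → Adj G u y → Adj G u x → y ≢ x →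
                           (q : Walk G y x) → u ∉ʷ q → ⊥
    neighbours-separated uy ux y≢x q u∉q with walk⇒path q
    ... | here , _ = y≢x refl
    ... | step e r , path , p⊆q , _ =
      long-path-ends-nonadjacent uy e r (¬Any⇒All¬ _ (u∉q ∘ p⊆q) ∷ path) (Adj-sym ux)

module SkewClosure {n : ℕ} (G : Graph n) where

  Adj? : ∀ u v → Dec (Adj G u v)
  Adj? u v = Graph.adj G u v Bool.≟ true

  SkewStep? : ∀ S w → Dec (SkewStep G S w)
  SkewStep? S w = any? λ u → Adj? u w ×-dec (¬? (w ∈? S) ×-dec
                    all? (λ x → Adj? u x →-dec (¬? (x ≟ w) →-dec (x ∈? S))))

  SkewClosed : Subset n → Set
  SkewClosed C = ∀ w → ¬ SkewStep G C w

  data Reach : Subset n → Subset n → Set where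
    stop  : ∀ {S} → Reach S S
    force : ∀ {S C} w → SkewStep G S w → Reach (S ∪ ⁅ w ⁆) C → Reach S C

  closure-within : ∀ k S → n ≤ k + ∣ S ∣ → Σ (Subset n) λ C → Reach S C × SkewClosed C
  closure-within zero S n≤∣S∣ = S , stop , λ { w (_ , _ , w∉S , _) → w∉S (subst (w ∈_) (sym S≡⊤) ∈⊤) }
    where
    S≡⊤ : S ≡ ⊤
    S≡⊤ = ∣p∣≡n⇒p≡⊤ (≤-antisym (∣p∣≤n S) n≤∣S∣)
  closure-within (suc k) S n≤k+∣S∣ with any? (SkewStep? S)
  ... | no stuck = S , stop , λ w st → stuck (w , st)
  ... | yes (w , st@(_ , _ , w∉S , _)) with closure-within k (S ∪ ⁅ w ⁆) n≤k+∣S∪w∣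
    where
    n≤k+∣S∪w∣ : n ≤ k + ∣ S ∪ ⁅ w ⁆ ∣
    n≤k+∣S∪w∣ = ≤-trans n≤k+∣S∣ (≤-trans (≤-reflexive (sym (+-suc k ∣ S ∣)))
                  (+-monoʳ-≤ k (p⊂q⇒∣p∣<∣q∣ (p⊆p∪q ⁅ w ⁆ , w , x∈p∪q⁺ (inj₂ (x∈⁅x⁆ w)) , w∉S))))
  ...   | C , reach , closed = C , force w st reach , closed

  closure : ∀ S → Σ (Subset n) λ C → Reach S C × SkewClosed C
  closure S = closure-within n S (m≤m+n n ∣ S ∣)

  reach-⊆ : ∀ {S C} → Reach S C → S ⊆ C
  reach-⊆ stop m = m
  reach-⊆ (force w _ reach) m = reach-⊆ reach (p⊆p∪q ⁅ w ⁆ m)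

  reach-run : ∀ {S C} → Reach S C → (∀ v → v ∈ C) → SkewRun G S
  reach-run stop full = done full
  reach-run (force w st reach) full = force w st (reach-run reach full)

  reach-B∅ : ∀ {S C} → Reach S C → (∀ {v} → v ∈ S → InB∅ G v) → ∀ {v} → v ∈ C → InB∅ G v
  reach-B∅ stop S⊆B∅ = S⊆B∅
  reach-B∅ (force w (u , uw , _ , others) reach) S⊆B∅ = reach-B∅ reach S∪w⊆B∅
    where
    S∪w⊆B∅ : ∀ {v} → v ∈ _ ∪ ⁅ w ⁆ → InB∅ G v
    S∪w⊆B∅ m with ∪⁅⁆⁻ m
    ... | inj₁ v∈S = S⊆B∅ v∈S
    ... | inj₂ refl = forced u w uw λ x ux x≢w → S⊆B∅ (others x ux x≢w)

  B∅⊆closed : ∀ {C v} → SkewClosed C → InB∅ G v → v ∈ C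
  B∅⊆closed {C} closed (forced u w uw others) with w ∈? C
  ... | yes w∈C = w∈C
  ... | no w∉C = ⊥-elim (closed w (u , uw , w∉C , λ x ux x≢w → B∅⊆closed closed (others x ux x≢w)))

  skewRun-fills-closed : ∀ {S C} → SkewRun G S → S ⊆ C → SkewClosed C → ∀ v → v ∈ C
  skewRun-fills-closed (done full) S⊆C closed v = S⊆C (full v)
  skewRun-fills-closed {C = C} (force w (u , uw , _ , others) run) S⊆C closed with w ∈? C
  ... | yes w∈C = skewRun-fills-closed run (∪⁅⁆-lub S⊆C w∈C) closed
  ... | no w∉C = ⊥-elim (closed w (u , uw , w∉C , λ x ux x≢w → S⊆C (others x ux x≢w)))

  skewRun-from-closed : ∀ {S} → (∀ {C} → S ⊆ C → SkewClosed C → ∀ v → v ∈ C) → SkewRun G S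
  skewRun-from-closed {S} fills with closure S
  ... | C , reach , closed = reach-run reach (fills (reach-⊆ reach) closed)

  skewRun? : Decidable (SkewRun G)
  skewRun? S with closure S
  ... | C , reach , closed with all? (_∈? C)
  ...   | yes full = yes (reach-run reach full)
  ...   | no ¬full = no λ run → ¬full (skewRun-fills-closed run (reach-⊆ reach) closed)

  skewRun-transfer : ∀ {S S′} → SkewRun G S → (∀ {v} → v ∈ S → v ∈ S′ ⊎ InB∅ G v) → SkewRun G S′
  skewRun-transfer run S⊆S′∪B∅ = skewRun-from-closed λ S′⊆C closed →
    skewRun-fills-closed run (λ v∈S → [ S′⊆C , B∅⊆closed closed ]′ (S⊆S′∪B∅ v∈S)) closed

  B∅ˢ : Subset n
  B∅ˢ = proj₁ (closure ∅)

  ∈B∅ˢ⇒InB∅ : ∀ {v} → v ∈ B∅ˢ → InB∅ G v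
  ∈B∅ˢ⇒InB∅ = reach-B∅ (proj₁ (proj₂ (closure ∅))) (⊥-elim ∘ ∉⊥)

  InB∅⇒∈B∅ˢ : ∀ {v} → InB∅ G v → v ∈ B∅ˢ
  InB∅⇒∈B∅ˢ = B∅⊆closed (proj₂ (proj₂ (closure ∅)))

  InB∅? : Decidable (InB∅ G)
  InB∅? v with v ∈? B∅ˢ
  ... | yes v∈B∅ = yes (∈B∅ˢ⇒InB∅ v∈B∅)
  ... | no v∉B∅ = no (v∉B∅ ∘ InB∅⇒∈B∅ˢ)

module PSDForcing {n : ℕ} (V : Fin n → Set) (A : Fin n → Fin n → Set) where

  PSDClosed : Subset n → Set
  PSDClosed C = ∀ w → ¬ PSDStep V A C w

  whiteWalk-start-white : ∀ {S a b} → WhiteWalk V A S a b → a ∉ S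
  whiteWalk-start-white (here _ a∉S) = a∉S
  whiteWalk-start-white (step _ a∉S _ _) = a∉S

  whiteWalk-mono : ∀ {S C a b} → (∀ {v} → V v → v ∉ S → v ∉ C) → WhiteWalk V A S a b → WhiteWalk V A C a b
  whiteWalk-mono f (here Va a∉S) = here Va (f Va a∉S)
  whiteWalk-mono f (step Va a∉S e walk) = step Va (f Va a∉S) e (whiteWalk-mono f walk)

  psdRun-fills-closed : ∀ {S C} → PSDRun V A S → S ⊆ C → PSDClosed C → ∀ v → V v → v ∈ C
  psdRun-fills-closed (done full) S⊆C closed v Vv = S⊆C (full v Vv)
  psdRun-fills-closed {C = C} (force w (u , u∈S , Vu , uw , Vw , _ , unique) run) S⊆C closed with w ∈? C
  ... | yes w∈C = psdRun-fills-closed run (∪⁅⁆-lub S⊆C w∈C) closed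
  ... | no w∉C = ⊥-elim (closed w (u , S⊆C u∈S , Vu , uw , Vw , w∉C , λ x Vx ux x≢w x∉C walk →
                   unique x Vx ux x≢w (x∉C ∘ S⊆C) (whiteWalk-mono (λ _ v∉C → v∉C ∘ S⊆C) walk)))

  psdRun-respects-V : ∀ {S S′} → PSDRun V A S′ →
                      (∀ {v} → V v → v ∈ S → v ∈ S′) → (∀ {v} → V v → v ∈ S′ → v ∈ S) → PSDRun V A S
  psdRun-respects-V (done full) _ S′⊆S = done λ v Vv → S′⊆S Vv (full v Vv)
  psdRun-respects-V (force w (u , u∈S′ , Vu , uw , Vw , w∉S′ , unique) run) S⊆S′ S′⊆S =
    force w (u , S′⊆S Vu u∈S′ , Vu , uw , Vw , w∉S′ ∘ S⊆S′ Vw ,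
             λ x Vx ux x≢w x∉S walk → unique x Vx ux x≢w (x∉S ∘ S′⊆S Vx)
               (whiteWalk-mono (λ Vv v∉S → v∉S ∘ S′⊆S Vv) walk))
      (psdRun-respects-V run (λ Vv → ∪⁅⁆-mono (S⊆S′ Vv)) (λ Vv → ∪⁅⁆-mono (S′⊆S Vv)))

module SD₂Forcing {n : ℕ} (T : Graph n) where
  open Walks T
  open SkewClosure T
  open PSDForcing (SD₂-V T) (SD₂-A T)

  skewClosed⇒psdClosed : ∀ {C} → SkewClosed C → PSDClosed C
  skewClosed⇒psdClosed {C} closed w (u , u∈C , _ , (_ , x , ux , wx) , Vw , w∉C , unique) =
    closed w (x , Adj-sym wx , w∉C , others-blue)
    where
    others-blue : ∀ y → Adj T x y → y ≢ w → y ∈ C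
    others-blue y xy y≢w with y ∈? C
    ... | yes y∈C = y∈C
    ... | no y∉C = ⊥-elim (unique y (y∉C ∘ B∅⊆closed closed) uy y≢w y∉C
                     (step (y∉C ∘ B∅⊆closed closed) y∉C (y≢w , x , Adj-sym xy , wx) (here Vw w∉C)))
      where
      uy : SD₂-A T u y
      uy = (λ { refl → y∉C u∈C }) , x , ux , Adj-sym xy

  psdRun⇒skewRun : ∀ {S} → PSDRun (SD₂-V T) (SD₂-A T) S → SkewRun T S
  psdRun⇒skewRun run = skewRun-from-closed λ {C} S⊆C closed v → case v ∈? C of λ where
    (yes v∈C) → v∈C
    (no v∉C) → psdRun-fills-closed run S⊆C (skewClosed⇒psdClosed closed) v (v∉C ∘ B∅⊆closed closed)

  other-W∅-neighbour : ∀ {x w} → Adj T x w → InW∅ T w → Σ (Fin n) λ u → Adj T x u × u ≢ w × InW∅ T u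
  other-W∅-neighbour {x} {w} xw w∉B∅ with any? (λ u → Adj? x u ×-dec ¬? (u ≟ w) ×-dec ¬? (InB∅? u))
  ... | yes found = found
  ... | no none = ⊥-elim (w∉B∅ (forced x w xw others-B∅))
    where
    others-B∅ : ∀ y → Adj T x y → y ≢ w → InB∅ T y
    others-B∅ y xy y≢w with InB∅? y
    ... | yes y∈B∅ = y∈B∅
    ... | no y∉B∅ = ⊥-elim (none (y , xy , y≢w , y∉B∅))

  module _ (acyclic : Acyclic T) where
    open Acyclicity acyclic

    OddWalkAvoiding : Fin n → Fin n → Fin n → Set
    OddWalkAvoiding u y a = Σ (Walk T y a) λ π → u ∉ʷ π × parity π ≡ true

    -- The common neighbour c of a and a′ is not u: preceded by the edge u – y, the odd
    -- walk from y to a becomes an even walk from u to a, so a is not adjacent to u.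
    whiteWalk-extends-oddWalkAvoiding : ∀ {D u y a b} → u ∈ D → Adj T u y →
      WhiteWalk (SD₂-V T) (SD₂-A T) D a b → OddWalkAvoiding u y a → OddWalkAvoiding u y b
    whiteWalk-extends-oddWalkAvoiding u∈D uy (here _ _) π = π
    whiteWalk-extends-oddWalkAvoiding {u = u} u∈D uy (step _ _ (_ , c , ac , a′c) walk) (π , u∉π , odd) =
      whiteWalk-extends-oddWalkAvoiding u∈D uy walk (π ▷ ac ▷ Adj-sym a′c , u∉π′ , odd′)
      where
      open ≡-Reasoning
      c≢u : c ≢ u
      c≢u refl = contradiction (begin
        true                          ≡⟨ sym odd ⟩
        parity π                      ≡⟨ sym (not-involutive _) ⟩
        not (not (parity π))          ≡⟨ sym (parity-▷ (step uy π) ac) ⟩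
        parity (step uy π ▷ ac)       ≡⟨ closed-walk-even (step uy π ▷ ac) ⟩
        false                         ∎) λ ()
      u∉π′ : u ∉ʷ (π ▷ ac ▷ Adj-sym a′c)
      u∉π′ = ∉ʷ-▷ (π ▷ ac) (Adj-sym a′c) (∉ʷ-▷ π ac u∉π (c≢u ∘ sym))
               λ { refl → whiteWalk-start-white walk u∈D }
      odd′ : parity (π ▷ ac ▷ Adj-sym a′c) ≡ true
      odd′ = trans (parity-▷▷ π ac (Adj-sym a′c)) odd

    skewStep⇒psdStep : ∀ {D w} → (∀ {v} → InB∅ T v → v ∈ D) → SkewStep T D w → PSDStep (SD₂-V T) (SD₂-A T) D w
    skewStep⇒psdStep {D} {w} B∅⊆D (x , xw , w∉D , others) with other-W∅-neighbour xw (w∉D ∘ B∅⊆D)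
    ... | u , xu , u≢w , Vu = u , u∈D , Vu , (u≢w , x , Adj-sym xu , Adj-sym xw) , w∉D ∘ B∅⊆D , w∉D , no-detour
      where
      u∈D : u ∈ D
      u∈D = others u xu u≢w
      no-detour : ∀ z → SD₂-V T z → SD₂-A T u z → z ≢ w → z ∉ D → ¬ WhiteWalk (SD₂-V T) (SD₂-A T) D z w
      no-detour z _ (_ , y , uy , zy) z≢w z∉D walk with y ≟ x
      ... | yes refl = z∉D (others z (Adj-sym zy) z≢w)
      ... | no y≢x with whiteWalk-extends-oddWalkAvoiding u∈D uy walk (yz , u∉yz , refl)
        where
        yz : Walk T y z
        yz = step (Adj-sym zy) here
        u∉yz : u ∉ʷ yz
        u∉yz (here refl) = Adj-irrefl uy
        u∉yz (there (here refl)) = z∉D u∈D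
      ...   | π , u∉π , _ = neighbours-separated uy (Adj-sym xu) y≢x (π ▷ Adj-sym xw)
                              (∉ʷ-▷ π (Adj-sym xw) u∉π λ { refl → Adj-irrefl xu })

    skewRun⇒psdRun-⊇B∅ : ∀ {D} → SkewRun T D → (∀ {v} → InB∅ T v → v ∈ D) → PSDRun (SD₂-V T) (SD₂-A T) D
    skewRun⇒psdRun-⊇B∅ (done full) _ = done λ v _ → full v
    skewRun⇒psdRun-⊇B∅ (force w st run) B∅⊆D =
      force w (skewStep⇒psdStep B∅⊆D st) (skewRun⇒psdRun-⊇B∅ run (p⊆p∪q ⁅ w ⁆ ∘ B∅⊆D))

    skewRun⇒psdRun : ∀ {S} → SkewRun T S → PSDRun (SD₂-V T) (SD₂-A T) S
    skewRun⇒psdRun {S} run = psdRun-respects-V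
      (skewRun⇒psdRun-⊇B∅ (skewRun-transfer run (inj₁ ∘ p⊆p∪q B∅ˢ)) (q⊆p∪q S B∅ˢ ∘ InB∅⇒∈B∅ˢ))
      (λ _ → p⊆p∪q B∅ˢ) S∪B∅⊆S
      where
      S∪B∅⊆S : ∀ {v} → SD₂-V T v → v ∈ S ∪ B∅ˢ → v ∈ S
      S∪B∅⊆S Vv m with x∈p∪q⁻ S B∅ˢ m
      ... | inj₁ v∈S = v∈S
      ... | inj₂ v∈B∅ = ⊥-elim (Vv (∈B∅ˢ⇒InB∅ v∈B∅))

minSize-exists : ∀ {n} {P : Subset n → Set} → Decidable P → ∀ m B → P B → ∣ B ∣ ≤ m → ∃[ k ] IsMinSize P k
minSize-exists P? zero B PB ∣B∣≤0 = ∣ B ∣ , (B , PB , refl) , λ _ _ → ≤-trans ∣B∣≤0 z≤n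
minSize-exists P? (suc m) B PB ∣B∣≤1+m with anySubset? (λ B′ → P? B′ ×-dec ∣ B′ ∣ ≤? m)
... | yes (B′ , PB′ , ∣B′∣≤m) = minSize-exists P? m B′ PB′ ∣B′∣≤m
... | no none = ∣ B ∣ , (B , PB , refl) ,
                λ B′ PB′ → ≤-trans ∣B∣≤1+m (≮⇒≥ λ { (s≤s ∣B′∣≤m) → none (B′ , PB′ , ∣B′∣≤m) })

module _ {n : ℕ} {P Q : Subset n → Set} {k : ℕ} (minP : IsMinSize P k)
         (Q⇒P : ∀ {S} → Q S → P S) (minimumP⇒Q : ∀ {S} → P S → ∣ S ∣ ≡ k → Q S) where

  IsMinSize-transfer : IsMinSize Q k
  IsMinSize-transfer = (B , minimumP⇒Q PB ∣B∣≡k , ∣B∣≡k) , λ S QS → proj₂ minP S (Q⇒P QS)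
    where
    B = proj₁ (proj₁ minP)
    PB = proj₁ (proj₂ (proj₁ minP))
    ∣B∣≡k = proj₂ (proj₂ (proj₁ minP))

  TEVertex-⇔ : ∀ S → TEVertex P k S ⇔ TEVertex Q k S
  TEVertex-⇔ S = mk⇔ (λ (PS , ∣S∣≡k) → minimumP⇒Q PS ∣S∣≡k , ∣S∣≡k) (λ (QS , ∣S∣≡k) → Q⇒P QS , ∣S∣≡k)

  TEEdge-⇔ : ∀ S₁ S₂ → TEEdge P k S₁ S₂ ⇔ TEEdge Q k S₁ S₂
  TEEdge-⇔ S₁ S₂ = mk⇔ (λ (v₁ , v₂ , adj) → to (TEVertex-⇔ S₁) v₁ , to (TEVertex-⇔ S₂) v₂ , adj)
                       (λ (v₁ , v₂ , adj) → from (TEVertex-⇔ S₁) v₁ , from (TEVertex-⇔ S₂) v₂ , adj)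
    where open Equivalence

minimum-skewForcingSet⊆W∅ : ∀ {n} {T : Graph n} {k B} → IsMinSize (SkewForcingSet T) k →
                             SkewForcingSet T B → ∣ B ∣ ≡ k → ∀ v → v ∈ B → InW∅ T v
minimum-skewForcingSet⊆W∅ {T = T} {B = B} (_ , minimal) run ∣B∣≡k v v∈B v∈B∅ =
  <-irrefl refl (≤-<-trans (minimal (B - v) run-without-v) (subst (∣ B - v ∣ <_) ∣B∣≡k (x∈p⇒∣p-x∣<∣p∣ v∈B)))
  where
  open SkewClosure T
  run-without-v : SkewRun T (B - v)
  run-without-v = skewRun-transfer run λ {x} x∈B → case x ≟ v of λ where
    (yes refl) → inj₂ v∈B∅
    (no x≢v) → inj₁ (x∈p∧x≢y⇒x∈p-y x∈B x≢v)

mainTheorem19 : {n : ℕ} (T : Graph n) → IsTree T → SkewNontrivial T →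
    ∃[ k ] (IsMinSize (SkewForcingSet T) k ×
            IsMinSize (PSDForcingSet (SD₂-V T) (SD₂-A T)) k ×
            (∀ S → TEVertex (SkewForcingSet T) k S
                     ⇔ TEVertex (PSDForcingSet (SD₂-V T) (SD₂-A T)) k S) ×
            (∀ S₁ S₂ → TEEdge (SkewForcingSet T) k S₁ S₂
                     ⇔ TEEdge (PSDForcingSet (SD₂-V T) (SD₂-A T)) k S₁ S₂))
mainTheorem19 {n} T (_ , _ , acyclic) _
  with minSize-exists (SkewClosure.skewRun? T) n ⊤ (done λ _ → ∈⊤) (∣p∣≤n ⊤)
... | k , minSkew = k , minSkew , IsMinSize-transfer minSkew psd⇒skew skew⇒psd ,
                    TEVertex-⇔ minSkew psd⇒skew skew⇒psd , TEEdge-⇔ minSkew psd⇒skew skew⇒psd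
  where
  open SD₂Forcing T
  psd⇒skew : ∀ {S} → PSDForcingSet (SD₂-V T) (SD₂-A T) S → SkewForcingSet T S
  psd⇒skew (_ , run) = psdRun⇒skewRun run
  skew⇒psd : ∀ {S} → SkewForcingSet T S → ∣ S ∣ ≡ k → PSDForcingSet (SD₂-V T) (SD₂-A T) S
  skew⇒psd run ∣S∣≡k = minimum-skewForcingSet⊆W∅ minSkew run ∣S∣≡k , skewRun⇒psdRun acyclic run
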